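{- Let $r$ be an even integer such that $r/2$ is even. Then every connected $r$-regular finite simple graph $G$ with an even number of vertices has a spanning subgraph $F$ such that $d_F(v)\in\{r/2-1,\ r/2+1\}$ for every vertex $v$ of $G$.
   Context: $d_F(v)$ denotes the degree of $v$ in the subgraph $F$. -}

module Defs where

open import Data.Nat using (ℕ; zero; suc; _+_)
open import Data.Bool using (Bool; true; false; if_then_else_)
open import Data.Fin using (Fin)
open import Data.List using (List; []; _∷_)
open import Data.Product using (Σ; _×_; _,_; ∃)
open import Data.Empty using (⊥)
open import Relation.Binary.PropositionalEquality using (_≡_)
open import Relation.Binary.Construct.Closure.ReflexiveTransitive using (Star)

record Graph (n : ℕ) : Set where
  field
    adj   : Fin n → Fin n → Bool
    sym   : ∀ u v → adj u v ≡ adj v u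
    irrefl : ∀ v → adj v v ≡ false
open Graph public

countTrue : ∀ {n} → (Fin n → Bool) → ℕ
countTrue {zero}  f = 0
countTrue {suc n} f = (if f Fin.zero then 1 else 0) + countTrue (λ i → f (Fin.suc i))

degree : ∀ {n} → Graph n → Fin n → ℕ
degree G v = countTrue (adj G v)

Regular : ∀ {n} → ℕ → Graph n → Set
Regular r G = ∀ v → degree G v ≡ r

Adj : ∀ {n} → Graph n → Fin n → Fin n → Set
Adj G u v = adj G u v ≡ true

Connected : ∀ {n} → Graph n → Set
Connected G = ∀ u v → Star (Adj G) u v

SpanningSubgraph : ∀ {n} → Graph n → Graph n → Set
SpanningSubgraph G F = ∀ u v → adj F u v ≡ true → adj G u v ≡ true

module Submission where

-- Since every degree is even and G is connected, G has an Euler circuit.  Walk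
-- along it from its start v₀ and colour its edges red and blue: the colour is
-- kept when the circuit enters a vertex for the first time and switched when it
-- re-enters a vertex already visited.  At a vertex x ≠ v₀ the first passage
-- through x contributes two edges of the same colour and every later passage
-- one edge of each colour, so x has r/2 ± 1 red edges, an odd number because
-- r/2 is even.  At v₀ only the first and the last edge of the circuit are
-- unpaired, so v₀ has r/2 or r/2 + 1 red edges; as the number of vertices is
-- even, the handshake lemma excludes the even value r/2.  The red edges form F.

open import Defs hiding (sym)
open import Data.Bool using (Bool; true; false; not; if_then_else_)
open import Data.Bool.Properties using (not-involutive)
open import Data.Empty using (⊥-elim)
open import Data.Fin using (Fin; zero; suc; _≟_)
open import Data.List using (List; []; _∷_; _++_; [_]; foldl)
open import Data.List.Membership.Propositional using (_∈_; _∉_)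
open import Data.List.Membership.Propositional.Properties using (∈-∃++)
open import Data.List.Properties using (foldl-++)
open import Data.List.Relation.Unary.Any using (here; there)
open import Data.Nat using (ℕ; zero; suc; _+_; _*_; _∸_; _≤_; _<_; z≤n; s≤s; _<?_; _<ᵇ_; parity)
open import Data.Nat.Induction using (<-wellFounded)
open import Data.Nat.Properties hiding (_≟_)
open import Data.Nat.Tactic.RingSolver using (solve-∀)
open import Algebra.Properties.Semiring.Sum +-*-semiring
  using (sum; sum-cong-≗; ∑-distrib-+; *-distribˡ-sum; sum-replicate-zero)
open import Data.Parity.Base as ℙ using (0ℙ; 1ℙ)
import Data.Parity.Properties as ℙ
open import Data.Product using (Σ; ∃; ∃₂; _×_; _,_; proj₁; proj₂)
open import Data.Sum using (_⊎_; inj₁; inj₂; map)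
open import Function using (_∘_; id)
open import Induction.WellFounded using (Acc; acc; WfRec)
open import Relation.Binary.Construct.Closure.ReflexiveTransitive using (Star; ε; _◅_)
open import Relation.Binary.PropositionalEquality
  using (_≡_; _≢_; refl; sym; trans; cong; cong₂; subst; subst₂; module ≡-Reasoning)
open import Relation.Nullary using (¬_; yes; no; does; contradiction)
open import Relation.Nullary.Decidable using (dec-true; dec-false; _×-dec_)

⟦_⟧ : Bool → ℕ
⟦ b ⟧ = if b then 1 else 0

⟦c⟧+⟦not-c⟧≡1 : ∀ c → ⟦ c ⟧ + ⟦ not c ⟧ ≡ 1
⟦c⟧+⟦not-c⟧≡1 true  = refl
⟦c⟧+⟦not-c⟧≡1 false = refl

+-double-injective : ∀ {m n} → m + m ≡ n + n → m ≡ n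
+-double-injective {m} {n} eq = *-cancelˡ-≡ m n 2 (begin
  2 * m      ≡⟨ cong (m +_) (+-identityʳ m) ⟩
  m + m      ≡⟨ eq ⟩
  n + n      ≡⟨ cong (n +_) (+-identityʳ n) ⟨
  2 * n      ∎)
  where open ≡-Reasoning

parity-double : ∀ m → parity (m + m) ≡ 0ℙ
parity-double m = trans (ℙ.+-homo-+ m m) (ℙ.p+p≡0ℙ (parity m))

ℙ-+-cancel-middle : ∀ p q s → (p ℙ.+ q) ℙ.+ (q ℙ.+ s) ≡ p ℙ.+ s
ℙ-+-cancel-middle p q s = begin
  (p ℙ.+ q) ℙ.+ (q ℙ.+ s)  ≡⟨ ℙ.+-assoc p q (q ℙ.+ s) ⟩
  p ℙ.+ (q ℙ.+ (q ℙ.+ s))  ≡⟨ cong (p ℙ.+_) (ℙ.+-assoc q q s) ⟨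
  p ℙ.+ ((q ℙ.+ q) ℙ.+ s)  ≡⟨ cong (λ t → p ℙ.+ (t ℙ.+ s)) (ℙ.p+p≡0ℙ q) ⟩
  p ℙ.+ s                  ∎
  where open ≡-Reasoning

sum-mono-≤ : ∀ {n} {f g : Fin n → ℕ} → (∀ i → f i ≤ g i) → sum f ≤ sum g
sum-mono-≤ {zero}  f≤g = z≤n
sum-mono-≤ {suc n} f≤g = +-mono-≤ (f≤g zero) (sum-mono-≤ (f≤g ∘ suc))

sum-<⇒∃< : ∀ {n} (f g : Fin n → ℕ) → sum f < sum g → ∃ λ i → f i < g i
sum-<⇒∃< {suc n} f g lt with f zero <? g zero
... | yes f₀<g₀ = zero , f₀<g₀
... | no  f₀≮g₀ with sum-<⇒∃< (f ∘ suc) (g ∘ suc) (+-cancelˡ-< (f zero) _ _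
                        (<-≤-trans lt (+-monoˡ-≤ _ (≮⇒≥ f₀≮g₀))))
...   | i , fᵢ<gᵢ = suc i , fᵢ<gᵢ

sum-≤-≡⇒≗ : ∀ {n} {f g : Fin n → ℕ} → (∀ i → f i ≤ g i) → sum f ≡ sum g → ∀ i → f i ≡ g i
sum-≤-≡⇒≗ {suc n} {f} {g} f≤g eq = pointwise
  where
  f₀≡g₀ : f zero ≡ g zero
  f₀≡g₀ = ≤-antisym (f≤g zero) (+-cancelʳ-≤ _ (g zero) (f zero)
            (≤-trans (+-monoʳ-≤ (g zero) (sum-mono-≤ (f≤g ∘ suc))) (≤-reflexive (sym eq))))
  pointwise : ∀ i → f i ≡ g i
  pointwise zero    = f₀≡g₀
  pointwise (suc i) = sum-≤-≡⇒≗ (f≤g ∘ suc) (+-cancelˡ-≡ (g zero) _ _ (subst (λ t → t + _ ≡ _) f₀≡g₀ eq)) i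

parity-sum-odd : ∀ {n} (f : Fin n → ℕ) → (∀ i → parity (f i) ≡ 1ℙ) → parity (sum f) ≡ parity n
parity-sum-odd {zero}  f odd = refl
parity-sum-odd {suc n} f odd = begin
  parity (f zero + sum (f ∘ suc))              ≡⟨ ℙ.+-homo-+ (f zero) _ ⟩
  parity (f zero) ℙ.+ parity (sum (f ∘ suc))   ≡⟨ cong₂ ℙ._+_ (odd zero) (parity-sum-odd (f ∘ suc) (odd ∘ suc)) ⟩
  1ℙ ℙ.+ parity n                              ≡⟨ ℙ.suc-homo-⁻¹ (suc n) ⟩
  parity (suc n)                               ∎
  where open ≡-Reasoning

δ : ∀ {n} → Fin n → Fin n → ℕ
δ i j = ⟦ does (i ≟ j) ⟧

module _ {n : ℕ} where

  δ-refl : (i : Fin n) → δ i i ≡ 1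
  δ-refl i = cong ⟦_⟧ (dec-true (i ≟ i) refl)

  δ-≢ : {i j : Fin n} → i ≢ j → δ i j ≡ 0
  δ-≢ {i} {j} i≢j = cong ⟦_⟧ (dec-false (i ≟ j) i≢j)

  δ*δ-off : {i j k l : Fin n} → ¬ (i ≡ j × k ≡ l) → δ i j * δ k l ≡ 0
  δ*δ-off {i} {j} {k} {l} off with i ≟ j | k ≟ l
  ... | no  _   | _       = refl
  ... | yes _   | no  _   = refl
  ... | yes i≡j | yes k≡l = ⊥-elim (off (i≡j , k≡l))

sum-δ : ∀ {n} (j : Fin n) → sum (λ i → δ i j) ≡ 1
sum-δ {suc n} zero    = cong suc (sum-replicate-zero n)
sum-δ {suc n} (suc j) = sum-δ j

-- Edge multisets on Fin n; an edge {x , y} is counted both at (x , y) and at (y , x).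
EdgeCount : ℕ → Set
EdgeCount n = Fin n → Fin n → ℕ

module _ {n : ℕ} where

  infixl 6 _+ᴱ_
  infixr 7 _·ᴱ_
  infix  4 _≤ᴱ_ _≗ᴱ_

  ∅ᴱ : EdgeCount n
  ∅ᴱ _ _ = 0

  _+ᴱ_ : EdgeCount n → EdgeCount n → EdgeCount n
  (E +ᴱ F) x y = E x y + F x y

  _·ᴱ_ : ℕ → EdgeCount n → EdgeCount n
  (k ·ᴱ E) x y = k * E x y

  _≤ᴱ_ : EdgeCount n → EdgeCount n → Set
  E ≤ᴱ F = ∀ x y → E x y ≤ F x y

  _≗ᴱ_ : EdgeCount n → EdgeCount n → Set
  E ≗ᴱ F = ∀ x y → E x y ≡ F x y

  SymmetricEdges : EdgeCount n → Set
  SymmetricEdges E = ∀ x y → E x y ≡ E y x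

  deg : EdgeCount n → Fin n → ℕ
  deg E x = sum (E x)

  size : EdgeCount n → ℕ
  size E = sum (deg E)

  edgesOf : Graph n → EdgeCount n
  edgesOf G x y = ⟦ adj G x y ⟧

  edge : Fin n → Fin n → EdgeCount n
  edge a b x y = δ x a * δ y b + δ x b * δ y a

  deg-∅ᴱ : ∀ x → deg ∅ᴱ x ≡ 0
  deg-∅ᴱ x = sum-replicate-zero n

  deg-+ᴱ : ∀ E F x → deg (E +ᴱ F) x ≡ deg E x + deg F x
  deg-+ᴱ E F x = ∑-distrib-+ (E x) (F x)

  deg-·ᴱ : ∀ k E x → deg (k ·ᴱ E) x ≡ k * deg E x
  deg-·ᴱ k E x = sym (*-distribˡ-sum k (E x))

  size-+ᴱ : ∀ E F → size (E +ᴱ F) ≡ size E + size F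
  size-+ᴱ E F = trans (sum-cong-≗ (deg-+ᴱ E F)) (∑-distrib-+ (deg E) (deg F))

  size-·ᴱ : ∀ k E → size (k ·ᴱ E) ≡ k * size E
  size-·ᴱ k E = trans (sum-cong-≗ (deg-·ᴱ k E)) (sym (*-distribˡ-sum k (deg E)))

  size-cong : ∀ {E F} → E ≗ᴱ F → size E ≡ size F
  size-cong E≗F = sum-cong-≗ (λ x → sum-cong-≗ (E≗F x))

  deg-mono-≤ : ∀ {E F} → E ≤ᴱ F → ∀ x → deg E x ≤ deg F x
  deg-mono-≤ E≤F x = sum-mono-≤ (E≤F x)

  size-mono-≤ : ∀ {E F} → E ≤ᴱ F → size E ≤ size F
  size-mono-≤ E≤F = sum-mono-≤ (deg-mono-≤ E≤F)

  size-<⇒∃< : ∀ E F → size E < size F → ∃₂ λ x y → E x y < F x y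
  size-<⇒∃< E F lt with sum-<⇒∃< (deg E) (deg F) lt
  ... | x , degE<degF with sum-<⇒∃< (E x) (F x) degE<degF
  ...   | y , lt′ = x , y , lt′

  ≤ᴱ∧size-≡⇒≗ᴱ : ∀ {E F} → E ≤ᴱ F → size E ≡ size F → E ≗ᴱ F
  ≤ᴱ∧size-≡⇒≗ᴱ E≤F eq x = sum-≤-≡⇒≗ (E≤F x) (sum-≤-≡⇒≗ (deg-mono-≤ E≤F) eq x)

  edge-sym : ∀ a b → SymmetricEdges (edge a b)
  edge-sym a b x y = begin
    δ x a * δ y b + δ x b * δ y a  ≡⟨ +-comm (δ x a * δ y b) _ ⟩
    δ x b * δ y a + δ x a * δ y b  ≡⟨ cong₂ _+_ (*-comm (δ x b) _) (*-comm (δ x a) _) ⟩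
    δ y a * δ x b + δ y b * δ x a  ∎
    where open ≡-Reasoning

  edge-comm : ∀ a b x y → edge a b x y ≡ edge b a x y
  edge-comm a b x y = +-comm (δ x a * δ y b) _

  edge-on : ∀ {a b} → a ≢ b → edge a b a b ≡ 1
  edge-on {a} {b} a≢b = cong₂ _+_ (cong₂ _*_ (δ-refl a) (δ-refl b)) (cong₂ _*_ (δ-≢ a≢b) (δ-≢ (a≢b ∘ sym)))

  edge-off : ∀ {a b x y} → ¬ (x ≡ a × y ≡ b) → ¬ (x ≡ b × y ≡ a) → edge a b x y ≡ 0
  edge-off off₁ off₂ = cong₂ _+_ (δ*δ-off off₁) (δ*δ-off off₂)

  edge-∉ : ∀ {a b y} x → y ≢ a → y ≢ b → edge a b x y ≡ 0
  edge-∉ {a} {b} {y} x y≢a y≢b = edge-off {a} {b} {x} {y} (y≢b ∘ proj₂) (y≢a ∘ proj₂)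

  deg-edge : ∀ a b x → deg (edge a b) x ≡ δ x a + δ x b
  deg-edge a b x = begin
    sum (λ y → δ x a * δ y b + δ x b * δ y a)
      ≡⟨ ∑-distrib-+ (λ y → δ x a * δ y b) _ ⟩
    sum (λ y → δ x a * δ y b) + sum (λ y → δ x b * δ y a)
      ≡⟨ cong₂ _+_ (*-distribˡ-sum (δ x a) (λ y → δ y b)) (*-distribˡ-sum (δ x b) (λ y → δ y a)) ⟨
    δ x a * sum (λ y → δ y b) + δ x b * sum (λ y → δ y a)
      ≡⟨ cong₂ (λ s t → δ x a * s + δ x b * t) (sum-δ b) (sum-δ a) ⟩
    δ x a * 1 + δ x b * 1
      ≡⟨ cong₂ _+_ (*-identityʳ (δ x a)) (*-identityʳ (δ x b)) ⟩
    δ x a + δ x b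
      ∎
    where open ≡-Reasoning

  deg-edge-away : ∀ {a b x} → x ≢ a → x ≢ b → deg (edge a b) x ≡ 0
  deg-edge-away {a} {b} {x} x≢a x≢b = trans (deg-edge a b x) (cong₂ _+_ (δ-≢ x≢a) (δ-≢ x≢b))

  size-edge : ∀ a b → size (edge a b) ≡ 2
  size-edge a b = begin
    sum (deg (edge a b))                   ≡⟨ sum-cong-≗ (deg-edge a b) ⟩
    sum (λ x → δ x a + δ x b)              ≡⟨ ∑-distrib-+ (λ x → δ x a) _ ⟩
    sum (λ x → δ x a) + sum (λ x → δ x b)  ≡⟨ cong₂ _+_ (sum-δ a) (sum-δ b) ⟩
    2                                      ∎
    where open ≡-Reasoning

end : ∀ {A : Set} → A → List A → A
end = foldl (λ _ b → b)

module _ {n : ℕ} where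

  walkEdges : Fin n → List (Fin n) → EdgeCount n
  walkEdges a []      = ∅ᴱ
  walkEdges a (b ∷ r) = edge a b +ᴱ walkEdges b r

  walkEdges-sym : ∀ a r → SymmetricEdges (walkEdges a r)
  walkEdges-sym a []      x y = refl
  walkEdges-sym a (b ∷ r) x y = cong₂ _+_ (edge-sym a b x y) (walkEdges-sym b r x y)

  walkEdges-++ : ∀ a p q x y → walkEdges a (p ++ q) x y ≡ walkEdges a p x y + walkEdges (end a p) q x y
  walkEdges-++ a []      q x y = refl
  walkEdges-++ a (b ∷ p) q x y =
    trans (cong (edge a b x y +_) (walkEdges-++ b p q x y)) (sym (+-assoc (edge a b x y) _ _))

  walkEdges-∉ : ∀ {y} a r x → y ∉ a ∷ r → walkEdges a r x y ≡ 0
  walkEdges-∉ a []      x _  = refl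
  walkEdges-∉ a (b ∷ r) x y∉ =
    cong₂ _+_ (edge-∉ x (y∉ ∘ here) (y∉ ∘ there ∘ here)) (walkEdges-∉ b r x (y∉ ∘ there))

  size-walkEdges-∷ : ∀ a b r → size (walkEdges a (b ∷ r)) ≡ 2 + size (walkEdges b r)
  size-walkEdges-∷ a b r = trans (size-+ᴱ (edge a b) (walkEdges b r)) (cong (_+ _) (size-edge a b))

  parity-deg-walkEdges : ∀ a r x → parity (deg (walkEdges a r) x) ≡ parity (δ x a + δ x (end a r))
  parity-deg-walkEdges a []      x = trans (cong parity (deg-∅ᴱ x)) (sym (parity-double (δ x a)))
  parity-deg-walkEdges a (b ∷ r) x = begin
    parity (deg (edge a b +ᴱ walkEdges b r) x)
      ≡⟨ cong parity (deg-+ᴱ (edge a b) (walkEdges b r) x) ⟩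
    parity (deg (edge a b) x + deg (walkEdges b r) x)
      ≡⟨ ℙ.+-homo-+ (deg (edge a b) x) _ ⟩
    parity (deg (edge a b) x) ℙ.+ parity (deg (walkEdges b r) x)
      ≡⟨ cong₂ ℙ._+_ (cong parity (deg-edge a b x)) (parity-deg-walkEdges b r x) ⟩
    parity (δ x a + δ x b) ℙ.+ parity (δ x b + δ x ℓ)
      ≡⟨ cong₂ ℙ._+_ (ℙ.+-homo-+ (δ x a) _) (ℙ.+-homo-+ (δ x b) _) ⟩
    (pa ℙ.+ pb) ℙ.+ (pb ℙ.+ pℓ)
      ≡⟨ ℙ-+-cancel-middle pa pb pℓ ⟩
    pa ℙ.+ pℓ
      ≡⟨ ℙ.+-homo-+ (δ x a) _ ⟨
    parity (δ x a + δ x ℓ)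
      ∎
    where
    open ≡-Reasoning
    ℓ = end b r
    pa = parity (δ x a)
    pb = parity (δ x b)
    pℓ = parity (δ x ℓ)

  rotate : ∀ {a r u} → end a r ≡ a → u ∈ a ∷ r →
           ∃ λ r′ → end u r′ ≡ u × walkEdges u r′ ≗ᴱ walkEdges a r
  rotate {r = r} closed (here refl) = r , closed , λ _ _ → refl
  rotate {a} {r} {u} closed (there u∈r) with ∈-∃++ u∈r
  ... | p , q , refl = q ++ p ++ [ u ] , closed′ , same
    where
    uq≡a : end u q ≡ a
    uq≡a = trans (sym (foldl-++ _ a p (u ∷ q))) closed
    closed′ : end u (q ++ p ++ [ u ]) ≡ u
    closed′ = trans (foldl-++ _ u q (p ++ [ u ])) (foldl-++ _ (end u q) p [ u ])
    same : walkEdges u (q ++ p ++ [ u ]) ≗ᴱ walkEdges a (p ++ u ∷ q)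
    same x y = begin
      walkEdges u (q ++ p ++ [ u ]) x y                    ≡⟨ walkEdges-++ u q (p ++ [ u ]) x y ⟩
      W u q + walkEdges (end u q) (p ++ [ u ]) x y         ≡⟨ cong (λ t → W u q + walkEdges t (p ++ [ u ]) x y) uq≡a ⟩
      W u q + walkEdges a (p ++ [ u ]) x y                 ≡⟨ cong (W u q +_) (walkEdges-++ a p [ u ] x y) ⟩
      W u q + (W a p + (edge (end a p) u x y + 0))         ≡⟨ rearrange (W a p) (edge (end a p) u x y) (W u q) ⟩
      W a p + (edge (end a p) u x y + W u q)               ≡⟨ walkEdges-++ a p (u ∷ q) x y ⟨
      walkEdges a (p ++ u ∷ q) x y                         ∎
      where
      open ≡-Reasoning
      W : Fin n → List (Fin n) → ℕ
      W v s = walkEdges v s x y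
      rearrange : ∀ A B C → C + (A + (B + 0)) ≡ A + (B + C)
      rearrange = solve-∀

countTrue≡sum : ∀ {n} (f : Fin n → Bool) → countTrue f ≡ sum (λ i → ⟦ f i ⟧)
countTrue≡sum {zero}  f = refl
countTrue≡sum {suc n} f = cong (⟦ f zero ⟧ +_) (countTrue≡sum (f ∘ suc))

<⟦⟧⇒≡0×true : ∀ {m b} → m < ⟦ b ⟧ → m ≡ 0 × b ≡ true
<⟦⟧⇒≡0×true {zero}  {true} _         = refl , refl
<⟦⟧⇒≡0×true {suc m} {true} (s≤s ())

module EulerCircuits {n : ℕ} (G : Graph n) where

  open import Data.List.Membership.DecPropositional (_≟_ {n}) using (_∈?_)

  degree≡deg : ∀ x → degree G x ≡ deg (edgesOf G) x
  degree≡deg x = countTrue≡sum (adj G x)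

  adj⇒≢ : ∀ {a b} → adj G a b ≡ true → a ≢ b
  adj⇒≢ {a} a~a refl = contradiction (trans (sym a~a) (irrefl G a)) λ ()

  Trail : Fin n → List (Fin n) → Set
  Trail a r = walkEdges a r ≤ᴱ edgesOf G

  Trail-resp : ∀ {a r u r′} → walkEdges u r′ ≗ᴱ walkEdges a r → Trail a r → Trail u r′
  Trail-resp same trail x y = subst (_≤ ⟦ adj G x y ⟧) (sym (same x y)) (trail x y)

  -- Trails grow at their first vertex a; their last vertex end a r stays fixed.
  extend : ∀ {a r w} → Trail a r → walkEdges a r a w < ⟦ adj G a w ⟧ → Trail w (a ∷ r)
  extend {a} {r} {w} trail unused with <⟦⟧⇒≡0×true unused
  ... | unused≡0 , a~w = extended
    where
    open ≡-Reasoning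
    w~a : adj G w a ≡ true
    w~a = trans (Graph.sym G w a) a~w
    extended : Trail w (a ∷ r)
    extended x y with x ≟ w ×-dec y ≟ a | x ≟ a ×-dec y ≟ w
    ... | yes (refl , refl) | _ = ≤-reflexive (begin
      edge w a w a + walkEdges a r w a  ≡⟨ cong₂ _+_ (edge-on (adj⇒≢ w~a))
                                                       (trans (walkEdges-sym a r w a) unused≡0) ⟩
      1                                 ≡⟨ cong ⟦_⟧ w~a ⟨
      ⟦ adj G w a ⟧                     ∎)
    ... | _ | yes (refl , refl) = ≤-reflexive (begin
      edge w a a w + walkEdges a r a w  ≡⟨ cong₂ _+_ (trans (edge-comm w a a w) (edge-on (adj⇒≢ a~w)))
                                                       unused≡0 ⟩
      1                                 ≡⟨ cong ⟦_⟧ a~w ⟨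
      ⟦ adj G a w ⟧                     ∎)
    ... | no off₁ | no off₂ =
      subst (_≤ ⟦ adj G x y ⟧) (cong (_+ walkEdges a r x y) (sym (edge-off {a = w} {a} {x} {y} off₁ off₂)))
            (trail x y)

  EvenDegrees : Set
  EvenDegrees = ∀ x → parity (degree G x) ≡ 0ℙ

  LongerTrail : Fin n → List (Fin n) → Set
  LongerTrail a r = ∃₂ λ a′ r′ → Trail a′ r′ × size (walkEdges a r) < size (walkEdges a′ r′)

  extend-longer : ∀ {a r w} → Trail a r → walkEdges a r a w < ⟦ adj G a w ⟧ → LongerTrail a r
  extend-longer {a} {r} {w} trail unused =
    w , a ∷ r , extend {a} {r} {w} trail unused ,
    subst (size (walkEdges a r) <_) (sym (size-walkEdges-∷ w a r)) (m<n+m _ (s≤s z≤n))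

  odd-end-deg-≢ : EvenDegrees → ∀ {a r} → a ≢ end a r → deg (walkEdges a r) a ≢ deg (edgesOf G) a
  odd-end-deg-≢ even {a} {r} a≢ℓ eq = contradiction (begin
    1ℙ                              ≡⟨ cong₂ (λ s t → parity (s + t)) (δ-refl a) (δ-≢ a≢ℓ) ⟨
    parity (δ a a + δ a (end a r))  ≡⟨ parity-deg-walkEdges a r a ⟨
    parity (deg (walkEdges a r) a)  ≡⟨ cong parity (trans eq (sym (degree≡deg a))) ⟩
    parity (degree G a)             ≡⟨ even a ⟩
    0ℙ                              ∎) λ ()
    where open ≡-Reasoning

  open-trail-extends : EvenDegrees → ∀ {a r} → Trail a r → a ≢ end a r → LongerTrail a r
  open-trail-extends even {a} {r} trail a≢ℓ
    with sum-<⇒∃< (walkEdges a r a) (edgesOf G a)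
                  (≤∧≢⇒< (deg-mono-≤ trail a) (odd-end-deg-≢ even {a} {r} a≢ℓ))
  ... | w , unused = extend-longer {a} {r} {w} trail unused

  -- Follow a path from the walk towards the unused edge until it first leaves the walk.
  unused-edge-at-walk : Connected G → ∀ {a r x y} → walkEdges a r x y < ⟦ adj G x y ⟧ →
                        ∃₂ λ u z → u ∈ a ∷ r × walkEdges a r u z < ⟦ adj G u z ⟧
  unused-edge-at-walk conn {a} {r} {x} {y} unused = search (here refl) (conn a x)
    where
    search : ∀ {v} → v ∈ a ∷ r → Star (Adj G) v x →
             ∃₂ λ u z → u ∈ a ∷ r × walkEdges a r u z < ⟦ adj G u z ⟧
    search v∈ ε = x , y , v∈ , unused
    search {v} v∈ (_◅_ {j = z} v~z path) with z ∈? a ∷ r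
    ... | yes z∈ = search z∈ path
    ... | no  z∉ = v , z , v∈ , subst₂ _<_ (sym (walkEdges-∉ a r v z∉)) (cong ⟦_⟧ (sym v~z)) (s≤s z≤n)

  closed-trail-extends : Connected G → ∀ {a r} → Trail a r → end a r ≡ a →
                         size (walkEdges a r) < size (edgesOf G) → LongerTrail a r
  closed-trail-extends conn {a} {r} trail closed incomplete
    with size-<⇒∃< (walkEdges a r) (edgesOf G) incomplete
  ... | _ , _ , unused with unused-edge-at-walk conn {a} {r} unused
  ...   | u , z , u∈ , unused′ with rotate closed u∈
  ...     | r′ , _ , same
    with extend-longer {u} {r′} {z} (Trail-resp {a} {r} {u} {r′} same trail) (subst (_< ⟦ adj G u z ⟧) (sym (same u z)) unused′)
  ...       | a′ , r″ , trail′ , longer = a′ , r″ , trail′ , subst (_< _) (size-cong same) longer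

  record EulerCircuit : Set where
    field
      start  : Fin n
      route  : List (Fin n)
      closed : end start route ≡ start
      covers : walkEdges start route ≗ᴱ edgesOf G

  eulerCircuit : EvenDegrees → Connected G → Fin n → EulerCircuit
  eulerCircuit even conn v = grow v [] (λ _ _ → z≤n) (<-wellFounded _)
    where
    spare : Fin n → List (Fin n) → ℕ
    spare a r = size (edgesOf G) ∸ size (walkEdges a r)

    mutual
      grow : ∀ a r → Trail a r → Acc _<_ (spare a r) → EulerCircuit
      grow a r trail (acc smaller) with a ≟ end a r | m≤n⇒m<n∨m≡n (size-mono-≤ trail)
      ... | yes a≡ℓ | inj₂ complete   =
        record { start = a ; route = r ; closed = sym a≡ℓ ; covers = ≤ᴱ∧size-≡⇒≗ᴱ trail complete }
      ... | yes a≡ℓ | inj₁ incomplete =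
        grow-longer {a} {r} (closed-trail-extends conn {a} {r} trail (sym a≡ℓ) incomplete) smaller
      ... | no  a≢ℓ | _ =
        grow-longer {a} {r} (open-trail-extends even {a} {r} trail a≢ℓ) smaller

      grow-longer : ∀ {a r} → LongerTrail a r → WfRec _<_ (Acc _<_) (spare a r) → EulerCircuit
      grow-longer (a′ , r′ , trail′ , longer) smaller =
        grow a′ r′ trail′ (smaller (∸-monoʳ-< longer (size-mono-≤ trail′)))

module Colouring {n : ℕ} where

  open import Data.List.Membership.DecPropositional (_≟_ {n}) using (_∈?_)

  nextColour : Bool → List (Fin n) → Fin n → Bool
  nextColour c seen b = if does (b ∈? seen) then not c else c

  nextColour-∈ : ∀ {b seen} c → b ∈ seen → nextColour c seen b ≡ not c
  nextColour-∈ {b} {seen} c b∈ = cong (if_then not c else c) (dec-true (b ∈? seen) b∈)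

  nextColour-∉ : ∀ {b seen} c → b ∉ seen → nextColour c seen b ≡ c
  nextColour-∉ {b} {seen} c b∉ = cong (if_then not c else c) (dec-false (b ∈? seen) b∉)

  -- The edges of the walk a r whose colour satisfies p, when its first edge gets colour c
  -- and the vertices in seen count as already visited.
  paint : (Bool → Bool) → Bool → List (Fin n) → Fin n → List (Fin n) → EdgeCount n
  paint p c seen a []      = ∅ᴱ
  paint p c seen a (b ∷ r) = ⟦ p c ⟧ ·ᴱ edge a b +ᴱ paint p (nextColour c seen b) (b ∷ seen) b r

  red blue : Bool → List (Fin n) → Fin n → List (Fin n) → EdgeCount n
  red  = paint id
  blue = paint not

  paint-sym : ∀ p c seen a r → SymmetricEdges (paint p c seen a r)
  paint-sym p c seen a []      x y = refl
  paint-sym p c seen a (b ∷ r) x y =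
    cong₂ _+_ (cong (⟦ p c ⟧ *_) (edge-sym a b x y)) (paint-sym p _ (b ∷ seen) b r x y)

  red+blue : ∀ c seen a r x y → red c seen a r x y + blue c seen a r x y ≡ walkEdges a r x y
  red+blue c seen a []      x y = refl
  red+blue c seen a (b ∷ r) x y = begin
    ⟦ c ⟧ * s + R + (⟦ not c ⟧ * s + B)  ≡⟨ regroup ⟦ c ⟧ ⟦ not c ⟧ s R B ⟩
    (⟦ c ⟧ + ⟦ not c ⟧) * s + (R + B)    ≡⟨ cong₂ (λ k t → k * s + t) (⟦c⟧+⟦not-c⟧≡1 c)
                                                                   (red+blue c′ (b ∷ seen) b r x y) ⟩
    1 * s + walkEdges b r x y            ≡⟨ cong (_+ walkEdges b r x y) (*-identityˡ s) ⟩
    s + walkEdges b r x y                ∎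
    where
    open ≡-Reasoning
    s = edge a b x y
    c′ = nextColour c seen b
    R = red c′ (b ∷ seen) b r x y
    B = blue c′ (b ∷ seen) b r x y
    regroup : ∀ C N s R B → C * s + R + (N * s + B) ≡ (C + N) * s + (R + B)
    regroup = solve-∀

  red≤ᴱwalkEdges : ∀ c seen a r → red c seen a r ≤ᴱ walkEdges a r
  red≤ᴱwalkEdges c seen a r x y = subst (red c seen a r x y ≤_) (red+blue c seen a r x y) (m≤m+n _ _)

  deg-paint-∷ : ∀ p c seen a b r x → deg (paint p c seen a (b ∷ r)) x ≡
                ⟦ p c ⟧ * (δ x a + δ x b) + deg (paint p (nextColour c seen b) (b ∷ seen) b r) x
  deg-paint-∷ p c seen a b r x = begin
    deg (⟦ p c ⟧ ·ᴱ edge a b +ᴱ P) x        ≡⟨ deg-+ᴱ (⟦ p c ⟧ ·ᴱ edge a b) P x ⟩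
    deg (⟦ p c ⟧ ·ᴱ edge a b) x + deg P x   ≡⟨ cong (_+ deg P x) (deg-·ᴱ ⟦ p c ⟧ (edge a b) x) ⟩
    ⟦ p c ⟧ * deg (edge a b) x + deg P x    ≡⟨ cong (λ t → ⟦ p c ⟧ * t + deg P x) (deg-edge a b x) ⟩
    ⟦ p c ⟧ * (δ x a + δ x b) + deg P x     ∎
    where
    open ≡-Reasoning
    P = paint p (nextColour c seen b) (b ∷ seen) b r

  parity-size-paint : ∀ p c seen a r → parity (size (paint p c seen a r)) ≡ 0ℙ
  parity-size-paint p c seen a []      = cong parity (trans (sum-cong-≗ {n} {deg ∅ᴱ} deg-∅ᴱ) (sum-replicate-zero n))
  parity-size-paint p c seen a (b ∷ r) = begin
    parity (size (k ·ᴱ edge a b +ᴱ P))               ≡⟨ cong parity (size-+ᴱ (k ·ᴱ edge a b) P) ⟩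
    parity (size (k ·ᴱ edge a b) + size P)           ≡⟨ ℙ.+-homo-+ (size (k ·ᴱ edge a b)) _ ⟩
    parity (size (k ·ᴱ edge a b)) ℙ.+ parity (size P) ≡⟨ cong₂ ℙ._+_ (cong parity twice-k)
                                                                     (parity-size-paint p _ (b ∷ seen) b r) ⟩
    parity (k + k) ℙ.+ 0ℙ                            ≡⟨ cong (ℙ._+ 0ℙ) (parity-double k) ⟩
    0ℙ                                               ∎
    where
    open ≡-Reasoning
    k = ⟦ p c ⟧
    P = paint p (nextColour c seen b) (b ∷ seen) b r
    twice-k : size (k ·ᴱ edge a b) ≡ k + k
    twice-k = begin
      size (k ·ᴱ edge a b)  ≡⟨ size-·ᴱ k (edge a b) ⟩
      k * size (edge a b)   ≡⟨ cong (k *_) (size-edge a b) ⟩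
      k * 2                 ≡⟨ *-comm k 2 ⟩
      k + (k + 0)           ≡⟨ cong (k +_) (+-identityʳ k) ⟩
      k + k                 ∎

  revisit-flips : ∀ {x b seen} c → x ∈ seen →
                  δ x b * ⟦ nextColour c seen b ⟧ ≡ δ x b * ⟦ not c ⟧ ×
                  δ x b * ⟦ not (nextColour c seen b) ⟧ ≡ δ x b * ⟦ c ⟧
  revisit-flips {x} {b} c x∈ with x ≟ b
  ... | no  _    = refl , refl
  ... | yes refl rewrite nextColour-∈ c x∈ | not-involutive c = refl , refl

  -- Once x has been visited, every passage through x enters and leaves it with different
  -- colours, so only the two ends of the walk unbalance the colours at x; d is the colour
  -- of the edge on which the walk reaches its end.
  revisits-balanced : ∀ {x} c seen a r → x ∈ seen → ∃ λ d →
    deg (red c seen a r) x + δ x a * ⟦ not c ⟧ + δ x (end a r) * ⟦ not d ⟧ ≡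
    deg (blue c seen a r) x + δ x a * ⟦ c ⟧ + δ x (end a r) * ⟦ d ⟧
  revisits-balanced {x} c seen a [] _ = not c , (begin
    Z + X * ⟦ not c ⟧ + X * ⟦ not (not c) ⟧  ≡⟨ cong (λ t → Z + X * ⟦ not c ⟧ + X * ⟦ t ⟧) (not-involutive c) ⟩
    Z + X * ⟦ not c ⟧ + X * ⟦ c ⟧            ≡⟨ swap Z (X * ⟦ not c ⟧) (X * ⟦ c ⟧) ⟩
    Z + X * ⟦ c ⟧ + X * ⟦ not c ⟧            ∎)
    where
    open ≡-Reasoning
    Z = deg ∅ᴱ x
    X = δ x a
    swap : ∀ Z A B → Z + A + B ≡ Z + B + A
    swap = solve-∀
  revisits-balanced {x} c seen a (b ∷ r) x∈ with revisits-balanced (nextColour c seen b) (b ∷ seen) b r (there x∈)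
  ... | d , balanced′ = d , (begin
    deg (red c seen a (b ∷ r)) x + A * N + L * ⟦ not d ⟧
      ≡⟨ cong (λ t → t + A * N + L * ⟦ not d ⟧) (deg-paint-∷ id c seen a b r x) ⟩
    C * (A + X) + R′ + A * N + L * ⟦ not d ⟧
      ≡⟨ regroup C N A X R′ (L * ⟦ not d ⟧) ⟩
    C * A + A * N + (R′ + X * C + L * ⟦ not d ⟧)
      ≡⟨ cong (λ t → C * A + A * N + (R′ + t + L * ⟦ not d ⟧)) (proj₂ flips) ⟨
    C * A + A * N + (R′ + X * ⟦ not c′ ⟧ + L * ⟦ not d ⟧)
      ≡⟨ cong (C * A + A * N +_) balanced′ ⟩
    C * A + A * N + (B′ + X * ⟦ c′ ⟧ + L * ⟦ d ⟧)
      ≡⟨ cong (λ t → C * A + A * N + (B′ + t + L * ⟦ d ⟧)) (proj₁ flips) ⟩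
    C * A + A * N + (B′ + X * N + L * ⟦ d ⟧)
      ≡⟨ regroup′ C N A X B′ (L * ⟦ d ⟧) ⟩
    N * (A + X) + B′ + A * C + L * ⟦ d ⟧
      ≡⟨ cong (λ t → t + A * C + L * ⟦ d ⟧) (deg-paint-∷ not c seen a b r x) ⟨
    deg (blue c seen a (b ∷ r)) x + A * C + L * ⟦ d ⟧ ∎)
    where
    open ≡-Reasoning
    c′ = nextColour c seen b
    C = ⟦ c ⟧
    N = ⟦ not c ⟧
    A = δ x a
    X = δ x b
    L = δ x (end b r)
    R′ = deg (red c′ (b ∷ seen) b r) x
    B′ = deg (blue c′ (b ∷ seen) b r) x
    flips = revisit-flips {b = b} c x∈
    regroup : ∀ C N A X R Q → C * (A + X) + R + A * N + Q ≡ C * A + A * N + (R + X * C + Q)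
    regroup = solve-∀
    regroup′ : ∀ C N A X B Q → C * A + A * N + (B + X * N + Q) ≡ N * (A + X) + B + A * C + Q
    regroup′ = solve-∀

  closed-walk-balanced : ∀ c seen a r → end a r ≡ a → a ∈ seen → ∃ λ d →
    deg (red c seen a r) a + ⟦ not c ⟧ + ⟦ not d ⟧ ≡ deg (blue c seen a r) a + ⟦ c ⟧ + ⟦ d ⟧
  closed-walk-balanced c seen a r closed a∈ with revisits-balanced c seen a r a∈
  ... | d , balanced = d , trans (sym (endpoints (deg (red c seen a r) a) ⟦ not c ⟧ ⟦ not d ⟧))
                                 (trans balanced (endpoints (deg (blue c seen a r) a) ⟦ c ⟧ ⟦ d ⟧))
    where
    δ-end≡1 : δ a (end a r) ≡ 1
    δ-end≡1 = trans (cong (δ a) closed) (δ-refl a)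
    endpoints : ∀ X u v → X + δ a a * u + δ a (end a r) * v ≡ X + u + v
    endpoints X u v = cong₂ (λ s t → X + s + t) (trans (cong (_* u) (δ-refl a)) (*-identityˡ u))
                                                (trans (cong (_* v) δ-end≡1) (*-identityˡ v))

  deg-paint-∷-away : ∀ {x a b} p c seen r → x ≢ a → x ≢ b →
    deg (paint p c seen a (b ∷ r)) x ≡ deg (paint p (nextColour c seen b) (b ∷ seen) b r) x
  deg-paint-∷-away {x} {a} {b} p c seen r x≢a x≢b =
    trans (deg-paint-∷ p c seen a b r x)
          (cong (_+ deg (paint p (nextColour c seen b) (b ∷ seen) b r) x)
                (trans (cong (⟦ p c ⟧ *_) (cong₂ _+_ (δ-≢ x≢a) (δ-≢ x≢b))) (*-zeroʳ ⟦ p c ⟧)))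

  first-entry-unbalanced : ∀ {x} c seen a r → x ∉ seen → x ≢ a → end x r ∈ seen →
    deg (red c seen a (x ∷ r)) x + 2 * ⟦ not c ⟧ ≡ deg (blue c seen a (x ∷ r)) x + 2 * ⟦ c ⟧
  first-entry-unbalanced {x} c seen a r x∉ x≢a ℓ∈
    with revisits-balanced (nextColour c seen x) (x ∷ seen) x r (here refl)
  ... | d , balanced = begin
    deg (red c seen a (x ∷ r)) x + 2 * N   ≡⟨ cong (_+ 2 * N) (deg-paint-∷ id c seen a x r x) ⟩
    C * (δ x a + δ x x) + R′ + 2 * N       ≡⟨ cong (λ t → C * t + R′ + 2 * N) enters ⟩
    C * 1 + R′ + 2 * N                     ≡⟨ regroup C N R′ ⟩
    R′ + N + (C + N)                       ≡⟨ cong (_+ (C + N)) balanced′ ⟩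
    B′ + C + (C + N)                       ≡⟨ regroup′ C N B′ ⟩
    N * 1 + B′ + 2 * C                     ≡⟨ cong (λ t → N * t + B′ + 2 * C) enters ⟨
    N * (δ x a + δ x x) + B′ + 2 * C       ≡⟨ cong (_+ 2 * C) (deg-paint-∷ not c seen a x r x) ⟨
    deg (blue c seen a (x ∷ r)) x + 2 * C  ∎
    where
    open ≡-Reasoning
    c′ = nextColour c seen x
    C = ⟦ c ⟧
    N = ⟦ not c ⟧
    R′ = deg (red c′ (x ∷ seen) x r) x
    B′ = deg (blue c′ (x ∷ seen) x r) x
    ℓ = end x r
    enters : δ x a + δ x x ≡ 1
    enters = cong₂ _+_ (δ-≢ x≢a) (δ-refl x)
    endpoints : ∀ X u v → X + δ x x * u + δ x ℓ * v ≡ X + u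
    endpoints X u v = trans (cong₂ (λ s t → X + s * u + t * v) (δ-refl x) (δ-≢ x≢ℓ)) (drop X u v)
      where
      x≢ℓ : x ≢ ℓ
      x≢ℓ x≡ℓ = x∉ (subst (_∈ seen) (sym x≡ℓ) ℓ∈)
      drop : ∀ X u v → X + 1 * u + 0 * v ≡ X + u
      drop = solve-∀
    c′≡c : c′ ≡ c
    c′≡c = nextColour-∉ c x∉
    balanced′ : R′ + N ≡ B′ + C
    balanced′ = begin
      R′ + N                                       ≡⟨ cong (λ t → R′ + ⟦ not t ⟧) c′≡c ⟨
      R′ + ⟦ not c′ ⟧                              ≡⟨ endpoints R′ ⟦ not c′ ⟧ ⟦ not d ⟧ ⟨
      R′ + δ x x * ⟦ not c′ ⟧ + δ x ℓ * ⟦ not d ⟧  ≡⟨ balanced ⟩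
      B′ + δ x x * ⟦ c′ ⟧ + δ x ℓ * ⟦ d ⟧          ≡⟨ endpoints B′ ⟦ c′ ⟧ ⟦ d ⟧ ⟩
      B′ + ⟦ c′ ⟧                                  ≡⟨ cong (λ t → B′ + ⟦ t ⟧) c′≡c ⟩
      B′ + C                                       ∎
    regroup : ∀ C N R → C * 1 + R + 2 * N ≡ R + N + (C + N)
    regroup = solve-∀
    regroup′ : ∀ C N B → B + C + (C + N) ≡ N * 1 + B + 2 * C
    regroup′ = solve-∀

  first-visit-unbalanced : ∀ {x} c seen a r → x ∉ seen → x ≢ a → end a r ∈ seen →
    (∃ λ d → deg (red c seen a r) x + 2 * ⟦ not d ⟧ ≡ deg (blue c seen a r) x + 2 * ⟦ d ⟧)
    ⊎ deg (walkEdges a r) x ≡ 0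
  first-visit-unbalanced {x} c seen a [] _ _ _ = inj₂ (deg-∅ᴱ x)
  -- Splitting on x ≟ b instead would also rewrite the δ x b hidden in the goal.
  first-visit-unbalanced {x} c seen a (b ∷ r) x∉ x≢a ℓ∈ with b ≟ x
  ... | yes refl = inj₁ (c , first-entry-unbalanced c seen a r x∉ x≢a ℓ∈)
  ... | no  b≢x with x≢b ← b≢x ∘ sym
                 | first-visit-unbalanced (nextColour c seen b) (b ∷ seen) b r
                     (λ { (here x≡b) → b≢x (sym x≡b) ; (there x∈) → x∉ x∈ }) (b≢x ∘ sym) (there ℓ∈)
  ...   | inj₂ unvisited =
    inj₂ (trans (deg-+ᴱ (edge a b) (walkEdges b r) x) (cong₂ _+_ (deg-edge-away x≢a x≢b) unvisited))
  ...   | inj₁ (d , unbalanced) =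
    inj₁ (d , subst₂ (λ R B → R + 2 * ⟦ not d ⟧ ≡ B + 2 * ⟦ d ⟧)
                     (sym (deg-paint-∷-away id c seen r x≢a x≢b)) (sym (deg-paint-∷-away not c seen r x≢a x≢b))
                     unbalanced)

module _ {n : ℕ} (G : Graph n) where

  ⟦0<ᵇ⟧ : ∀ {m} → m ≤ 1 → ⟦ 0 <ᵇ m ⟧ ≡ m
  ⟦0<ᵇ⟧ {zero}  _ = refl
  ⟦0<ᵇ⟧ {suc zero} _ = refl
  ⟦0<ᵇ⟧ {suc (suc m)} (s≤s ())

  ⟦⟧≤1 : ∀ b → ⟦ b ⟧ ≤ 1
  ⟦⟧≤1 true  = s≤s z≤n
  ⟦⟧≤1 false = z≤n

  spanningSubgraph : (E : EdgeCount n) → SymmetricEdges E → E ≤ᴱ edgesOf G →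
                     Σ (Graph n) λ F → SpanningSubgraph G F × ∀ x → degree F x ≡ deg E x
  spanningSubgraph E E-sym E≤G = F , F⊆G , degree-F
    where
    F : Graph n
    F = record
      { adj    = λ x y → 0 <ᵇ E x y
      ; sym    = λ x y → cong (0 <ᵇ_) (E-sym x y)
      ; irrefl = λ x → cong (0 <ᵇ_) (n≤0⇒n≡0 (subst (E x x ≤_) (cong ⟦_⟧ (irrefl G x)) (E≤G x x)))
      }
    F⊆G : SpanningSubgraph G F
    F⊆G x y _ with E x y | E≤G x y
    ... | suc _ | 1≤⟦adj⟧ with adj G x y
    ...   | true = refl
    degree-F : ∀ x → degree F x ≡ deg E x
    degree-F x = trans (countTrue≡sum (adj F x))
                       (sum-cong-≗ (λ y → ⟦0<ᵇ⟧ (≤-trans (E≤G x y) (⟦⟧≤1 (adj G x y)))))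

r+b≡s+s∧r≡b⇒r≡s : ∀ {r b s} → r + b ≡ s + s → r ≡ b → r ≡ s
r+b≡s+s∧r≡b⇒r≡s {r} r+b≡s+s r≡b = +-double-injective (trans (cong (r +_) r≡b) r+b≡s+s)

r+b≡s+s∧r+2≡b⇒r+1≡s : ∀ {r b s} → r + b ≡ s + s → r + 2 ≡ b → r + 1 ≡ s
r+b≡s+s∧r+2≡b⇒r+1≡s {r} {b} {s} r+b≡s+s r+2≡b = +-double-injective (begin
  r + 1 + (r + 1)  ≡⟨ regroup r ⟩
  r + (r + 2)      ≡⟨ cong (r +_) r+2≡b ⟩
  r + b            ≡⟨ r+b≡s+s ⟩
  s + s            ∎)
  where
  open ≡-Reasoning
  regroup : ∀ r → r + 1 + (r + 1) ≡ r + (r + 2)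
  regroup = solve-∀

r+b≡s+s∧r≡b+2⇒r≡s+1 : ∀ {r b s} → r + b ≡ s + s → r ≡ b + 2 → r ≡ s + 1
r+b≡s+s∧r≡b+2⇒r≡s+1 {r} {b} {s} r+b≡s+s r≡b+2 = begin
  r          ≡⟨ r≡b+2 ⟩
  b + 2      ≡⟨ +-assoc b 1 1 ⟨
  b + 1 + 1  ≡⟨ cong (_+ 1) (r+b≡s+s∧r+2≡b⇒r+1≡s (trans (+-comm b r) r+b≡s+s) (sym r≡b+2)) ⟩
  s + 1      ∎
  where open ≡-Reasoning

parity-2*+1 : ∀ m → parity (2 * m + 1) ≡ 1ℙ
parity-2*+1 m = trans (ℙ.+-homo-+ (2 * m) 1) (cong (ℙ._+ 1ℙ) (ℙ.*-homo-* 2 m))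

r+1≡2*m⇒parity-r≡1ℙ : ∀ {r m} → r + 1 ≡ 2 * m → parity r ≡ 1ℙ
r+1≡2*m⇒parity-r≡1ℙ {r} {m} r+1≡2m = p+1ℙ≡0ℙ⇒p≡1ℙ (parity r)
  (trans (sym (ℙ.+-homo-+ r 1)) (trans (cong parity r+1≡2m) (ℙ.*-homo-* 2 m)))
  where
  p+1ℙ≡0ℙ⇒p≡1ℙ : ∀ p → p ℙ.+ 1ℙ ≡ 0ℙ → p ≡ 1ℙ
  p+1ℙ≡0ℙ⇒p≡1ℙ 1ℙ _ = refl

4*m≡2*m+2*m : ∀ m → 4 * m ≡ 2 * m + 2 * m
4*m≡2*m+2*m = solve-∀

module OddNearHalfFactor {n : ℕ} (G : Graph n) (k : ℕ) (regular : Regular (4 * suc k) G)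
                         (n-even : parity n ≡ 0ℙ) (circuit : EulerCircuits.EulerCircuit G) where

  open EulerCircuits G
  open EulerCircuit circuit
  open Colouring

  K : ℕ
  K = suc k

  red₀ blue₀ : EdgeCount n
  red₀  = red  true [ start ] start route
  blue₀ = blue true [ start ] start route

  R B : Fin n → ℕ
  R = deg red₀
  B = deg blue₀

  deg-circuit : ∀ x → deg (walkEdges start route) x ≡ 4 * K
  deg-circuit x = trans (sum-cong-≗ (covers x)) (trans (sym (degree≡deg x)) (regular x))

  R+B≡2K+2K : ∀ x → R x + B x ≡ 2 * K + 2 * K
  R+B≡2K+2K x = begin
    R x + B x                      ≡⟨ deg-+ᴱ red₀ blue₀ x ⟨
    deg (red₀ +ᴱ blue₀) x          ≡⟨ sum-cong-≗ (red+blue true [ start ] start route x) ⟩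
    deg (walkEdges start route) x  ≡⟨ deg-circuit x ⟩
    4 * K                          ≡⟨ 4*m≡2*m+2*m K ⟩
    2 * K + 2 * K                  ∎
    where open ≡-Reasoning

  red-degree-away : ∀ {x} → x ≢ start → R x + 1 ≡ 2 * K ⊎ R x ≡ 2 * K + 1
  red-degree-away {x} x≢s
    with first-visit-unbalanced true [ start ] start route (λ { (here x≡s) → x≢s x≡s }) x≢s (here closed)
  ... | inj₁ (false , R+2≡B+0) =
    inj₁ (r+b≡s+s∧r+2≡b⇒r+1≡s {s = 2 * K} (R+B≡2K+2K x) (trans R+2≡B+0 (+-identityʳ (B x))))
  ... | inj₁ (true , R+0≡B+2) =
    inj₂ (r+b≡s+s∧r≡b+2⇒r≡s+1 {s = 2 * K} (R+B≡2K+2K x) (trans (sym (+-identityʳ (R x))) R+0≡B+2))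
  ... | inj₂ unvisited = contradiction (trans (sym unvisited) (deg-circuit x)) λ ()

  red-degree-start : R start ≡ 2 * K ⊎ R start ≡ 2 * K + 1
  red-degree-start with closed-walk-balanced true [ start ] start route closed (here refl)
  ... | false , R+0+1≡B+1+0 = inj₁ (r+b≡s+s∧r≡b⇒r≡s {s = 2 * K} (R+B≡2K+2K start) (+-cancelʳ-≡ 1 _ _ (begin
    R start + 1       ≡⟨ cong (_+ 1) (+-identityʳ (R start)) ⟨
    R start + 0 + 1   ≡⟨ R+0+1≡B+1+0 ⟩
    B start + 1 + 0   ≡⟨ +-identityʳ (B start + 1) ⟩
    B start + 1       ∎)))
    where open ≡-Reasoning
  ... | true , R+0+0≡B+1+1 = inj₂ (r+b≡s+s∧r≡b+2⇒r≡s+1 {s = 2 * K} (R+B≡2K+2K start) (begin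
    R start           ≡⟨ +-identityʳ (R start) ⟨
    R start + 0       ≡⟨ +-identityʳ (R start + 0) ⟨
    R start + 0 + 0   ≡⟨ R+0+0≡B+1+1 ⟩
    B start + 1 + 1   ≡⟨ +-assoc (B start) 1 1 ⟩
    B start + 2       ∎))
    where open ≡-Reasoning

  parity-red-degree-away : ∀ {x} → x ≢ start → parity (R x) ≡ 1ℙ
  parity-red-degree-away x≢s with red-degree-away x≢s
  ... | inj₁ R+1≡2K = r+1≡2*m⇒parity-r≡1ℙ {m = K} R+1≡2K
  ... | inj₂ R≡2K+1 = trans (cong parity R≡2K+1) (parity-2*+1 K)

  red-degree-start-odd : R start ≡ 2 * K + 1
  red-degree-start-odd with red-degree-start
  ... | inj₂ R≡2K+1 = R≡2K+1
  -- Otherwise R + δ · start is odd everywhere, so its sum, sum R + 1, has the parity of n,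
  -- which is even; but sum R = size red₀ is even.
  ... | inj₁ R≡2K = contradiction (begin
    1ℙ                                                ≡⟨ cong₂ ℙ._+_ handshake (cong parity (sum-δ start)) ⟨
    parity (sum R) ℙ.+ parity (sum (λ x → δ x start)) ≡⟨ ℙ.+-homo-+ (sum R) _ ⟨
    parity (sum R + sum (λ x → δ x start))            ≡⟨ cong parity (∑-distrib-+ R (λ x → δ x start)) ⟨
    parity (sum (λ x → R x + δ x start))              ≡⟨ parity-sum-odd (λ x → R x + δ x start) odd ⟩
    parity n                                          ≡⟨ n-even ⟩
    0ℙ                                                ∎) λ ()
    where
    open ≡-Reasoning
    handshake : parity (sum R) ≡ 0ℙ
    handshake = parity-size-paint id true [ start ] start route
    odd : ∀ x → parity (R x + δ x start) ≡ 1ℙ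
    odd x with start ≟ x
    ... | yes refl = trans (cong parity (cong₂ _+_ R≡2K (δ-refl start))) (parity-2*+1 K)
    ... | no  s≢x  = trans (cong parity (trans (cong (R x +_) (δ-≢ (s≢x ∘ sym))) (+-identityʳ (R x))))
                           (parity-red-degree-away (s≢x ∘ sym))

  red-degree : ∀ x → R x + 1 ≡ 2 * K ⊎ R x ≡ 2 * K + 1
  red-degree x with start ≟ x
  ... | yes refl = inj₂ red-degree-start-odd
  ... | no  s≢x  = red-degree-away (s≢x ∘ sym)

  factor : Σ (Graph n) λ F → SpanningSubgraph G F × ∀ x → degree F x ≡ 2 * K ∸ 1 ⊎ degree F x ≡ 2 * K + 1
  factor with spanningSubgraph G red₀ (paint-sym id true [ start ] start route)
                (λ x y → ≤-trans (red≤ᴱwalkEdges true [ start ] start route x y) (≤-reflexive (covers x y)))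
  ... | F , F⊆G , degree-F = F , F⊆G , λ x → map (below x) (trans (degree-F x)) (red-degree x)
    where
    below : ∀ x → R x + 1 ≡ 2 * K → degree F x ≡ 2 * K ∸ 1
    below x R+1≡2K = trans (degree-F x) (trans (sym (m+n∸n≡m (R x) 1)) (cong (_∸ 1) R+1≡2K))

edgeless : ∀ {n} → Graph n
edgeless = record { adj = λ _ _ → false ; sym = λ _ _ → refl ; irrefl = λ _ → refl }

degree-edgeless : ∀ {n} (x : Fin n) → degree edgeless x ≡ 0
degree-edgeless {n} x = trans (countTrue≡sum {n} (λ _ → false)) (sum-replicate-zero n)

theorem2p2 : (k m : ℕ) (G : Graph (2 * m)) → Regular (4 * k) G → Connected G →
    Σ (Graph (2 * m)) (λ F → SpanningSubgraph G F ×
      (∀ (v : Fin (2 * m)) → (degree F v ≡ 2 * k ∸ 1) ⊎ (degree F v ≡ 2 * k + 1)))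
-- For r = 0 the edgeless graph works because 2 * 0 ∸ 1 = 0.
theorem2p2 zero    m       G _       _         = edgeless , (λ _ _ ()) , inj₁ ∘ degree-edgeless
theorem2p2 (suc k) zero    G _       _         = edgeless , (λ _ _ ()) , λ ()
theorem2p2 (suc k) (suc m) G regular connected =
  OddNearHalfFactor.factor G k regular (ℙ.*-homo-* 2 (suc m)) (EulerCircuits.eulerCircuit G even-degrees connected zero)
  where
  even-degrees : EulerCircuits.EvenDegrees G
  even-degrees x = trans (cong parity (trans (regular x) (4*m≡2*m+2*m (suc k)))) (parity-double (2 * suc k))
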